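{- Let $A$ be a finite alphabet and let $F$ be a dill map on $A^{\mathbb N}$ with diameter $\theta$ and local rule $f$. The following are equivalent: (1) $F$ is diamond-uniform; (2) there is a constant $C$ such that $|f^*(u)|-|f^*(v)|\le C$ for all finite words $u,v$ with $|u|=|v|$.
   Context: Write $u_{[a,b)}=u_a\cdots u_{b-1}$. A dill map with diameter $\theta\ge1$ and local rule $f:A^\theta\to A^+$ is $F(x)=f(x_{[0,\theta)})f(x_{[1,\theta+1)})\cdots$. Define $f^*:A^*\to A^*$ by $f^*(u)=f(u_{[0,\theta)})f(u_{[1,\theta+1)})\cdots f(u_{[|u|-\theta,|u|)})$ if $|u|\ge\theta$ and $f^*(u)$ the empty word otherwise. $F$ is diamond-uniform if for every $\ell$ and all $u,v\in A^\ell$ with $u_{[0,\theta)}=v_{[0,\theta)}$ and $u_{[\ell-\theta,\ell)}=v_{[\ell-\theta,\ell)}$, one has $|f^*(u)|=|f^*(v)|$. -}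

module Defs where

open import Data.Nat using (ℕ; zero; suc; _<_)
open import Data.List using (List; []; _∷_; _++_; length; take; drop; reverse)
open import Data.Vec using (Vec; []; _∷_)
open import Data.Maybe using (Maybe; just; nothing)
open import Data.Product using (_×_)
open import Relation.Binary.PropositionalEquality using (_≡_)

prefixVec : {A : Set} (θ : ℕ) → List A → Maybe (Vec A θ)
prefixVec zero    _        = just []
prefixVec (suc θ) []       = nothing
prefixVec (suc θ) (a ∷ u) with prefixVec θ u
... | just w  = just (a ∷ w)
... | nothing = nothing

-- f* (u) = f(u[0,θ)) f(u[1,θ+1)) ... f(u[|u|-θ,|u|)), and the empty word if |u| < θ.
fstar : {A : Set} (θ : ℕ) (f : Vec A θ → List A) → List A → List A
fstar θ f []       = []
fstar θ f (a ∷ u) with prefixVec θ (a ∷ u)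
... | just w  = f w ++ fstar θ f u
... | nothing = []

IsLocalRule : {A : Set} (θ : ℕ) → (Vec A θ → List A) → Set
IsLocalRule θ f = ∀ w → 0 < length (f w)

-- Diamond-uniformity: for all ℓ and u, v of length ℓ with the same prefix of
-- length θ and the same suffix of length θ, |f*(u)| = |f*(v)|.
-- u_[ℓ-θ,ℓ) is expressed as the first θ letters of the reversed word, reversed back
-- (take θ of reverse), which gives the same equality condition.
DiamondUniform : {A : Set} (θ : ℕ) (f : Vec A θ → List A) → Set
DiamondUniform {A} θ f =
  (ℓ : ℕ) (u v : List A) → length u ≡ ℓ → length v ≡ ℓ →
  take θ u ≡ take θ v →
  take θ (reverse u) ≡ take θ (reverse v) →
  length (fstar θ f u) ≡ length (fstar θ f v)

{-# OPTIONS --safe #-}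
-- Let θ = t + 1 be the window length and M a bound on the lengths |f w| (the alphabet is finite).
-- If |r| = t, every window of x r y lies in exactly one of x r and r y, so
--   f*(x r y) = f*(x r) f*(r y).
-- (1 ⇒ 2) Hence replacing a prefix or a suffix of length θ changes |f*| by at most θM. Giving u the
-- two ends of v costs at most 2θM, and by diamond-uniformity the result has the same |f*| as v.
-- (2 ⇒ 1) If u and v share their first t letters q and their last t letters s, the identity gives
-- |f*(s u)| = |f*(s q)| + |f*(u)|, and |f*(s uⁿ)| = n |f*(s u)| because u ends in s; the same holds
-- for v. Bounded differences between |f*(s uⁿ)| and |f*(s vⁿ)| for all n force |f*(u)| = |f*(v)|.
module Submission where

open import Data.Fin as Fin using (Fin)
open import Data.Integer using (ℤ; +_; _-_; _⊖_)
import Data.Integer as ℤ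
import Data.Integer.Properties as ℤ
open import Data.List using (List; []; _∷_; _++_; length; take; drop; reverse; concat; replicate)
open import Data.List.Properties
  using (length-++; length-++-≤ʳ; ++-assoc; ++-identityʳ; length-take; length-drop; take++drop≡id; take-take;
         reverse-++; reverse-injective; length-reverse)
open import Data.Maybe using (just; nothing)
open import Data.Nat using (ℕ; zero; suc; _+_; _*_; _∸_; _⊔_; _⊓_; _≤_; _≰_; _<_; z≤n; s≤s; _≤?_)
open import Data.Nat.Properties
open import Data.Product using (Σ; ∃; ∃₂; _×_; _,_; proj₁; proj₂)
open import Data.Vec using (Vec; []; _∷_)
open import Function.Bundles using (_⇔_; mk⇔)
open import Relation.Binary.PropositionalEquality
open import Relation.Nullary using (yes; no; contradiction)

open import Defs

*-gap-bounded⇒≤ : ∀ {a b} K → (∀ n → n * a ≤ n * b + K) → a ≤ b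
*-gap-bounded⇒≤ {a} {b} K bounded with a ≤? b
... | yes a≤b = a≤b
... | no a≰b = contradiction (≤-trans (*-monoʳ-≤ (suc K) (≰⇒> a≰b)) (bounded (suc K))) gap-too-large
  where
  gap-too-large : suc K * suc b ≰ suc K * b + K
  gap-too-large le = 1+n≰n (begin
    suc (suc K * b + K) ≡⟨ cong suc (+-comm (suc K * b) K) ⟩
    suc K + suc K * b   ≡⟨ *-suc (suc K) b ⟨
    suc K * suc b       ≤⟨ le ⟩
    suc K * b + K       ∎)
    where open ≤-Reasoning

m≤n+o⇒[+m]-[+n]≤+o : ∀ {m n o} → m ≤ n + o → + m - + n ℤ.≤ + o
m≤n+o⇒[+m]-[+n]≤+o {m} {n} {o} m≤n+o rewrite ℤ.[+m]-[+n]≡m⊖n m n = begin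
  m ⊖ n         ≤⟨ ℤ.⊖-monoˡ-≤ n m≤n+o ⟩
  (n + o) ⊖ n   ≡⟨ ℤ.≤-⊖ (m≤m+n n o) ⟩
  + (n + o ∸ n) ≡⟨ cong +_ (m+n∸m≡n n o) ⟩
  + o           ∎
  where open ℤ.≤-Reasoning

[+m]-[+n]≤+o⇒m≤n+o : ∀ {m n o} → + m - + n ℤ.≤ + o → m ≤ n + o
[+m]-[+n]≤+o⇒m≤n+o {m} {n} {o} [+m]-[+n]≤+o with m ≤? n + o
... | yes m≤n+o = m≤n+o
... | no m≰n+o = contradiction [+m]-[+n]≤+o (ℤ.<⇒≱ (begin-strict
  + o           ≡⟨ cong +_ (m+n∸m≡n n o) ⟨
  + (n + o ∸ n) ≡⟨ ℤ.≤-⊖ (m≤m+n n o) ⟨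
  (n + o) ⊖ n   <⟨ ℤ.⊖-monoˡ-< n (≰⇒> m≰n+o) ⟩
  m ⊖ n         ≡⟨ ℤ.[+m]-[+n]≡m⊖n m n ⟨
  + m - + n     ∎))
  where open ℤ.≤-Reasoning

i≤+∣i∣ : ∀ i → i ℤ.≤ + ℤ.∣ i ∣
i≤+∣i∣ (+ n)     = ℤ.≤-refl
i≤+∣i∣ ℤ.-[1+ n ] = ℤ.-≤+

Fin-bounded : ∀ {k} (g : Fin k → ℕ) → ∃ λ M → ∀ i → g i ≤ M
Fin-bounded {zero}  g = 0 , λ ()
Fin-bounded {suc k} g with Fin-bounded (λ i → g (Fin.suc i))
... | M , g∘suc≤M = g Fin.zero ⊔ M , λ
  { Fin.zero    → m≤m⊔n _ M
  ; (Fin.suc i) → ≤-trans (g∘suc≤M i) (m≤n⊔m (g Fin.zero) M)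
  }

Vec-Fin-bounded : ∀ {k} n (g : Vec (Fin k) n → ℕ) → ∃ λ M → ∀ w → g w ≤ M
Vec-Fin-bounded zero    g = g [] , λ { [] → ≤-refl }
Vec-Fin-bounded (suc n) g with Fin-bounded (λ i → proj₁ (Vec-Fin-bounded n (λ w → g (i ∷ w))))
... | M , ≤M = M , λ { (i ∷ w) → ≤-trans (proj₂ (Vec-Fin-bounded n (λ w → g (i ∷ w))) w) (≤M i) }

module _ {A : Set} where

  prefixVec-short : ∀ n (xs : List A) → length xs < n → prefixVec n xs ≡ nothing
  prefixVec-short (suc n) []       _          = refl
  prefixVec-short (suc n) (x ∷ xs) (s≤s |xs|<n) rewrite prefixVec-short n xs |xs|<n = refl

  prefixVec-long : ∀ n (xs : List A) → n ≤ length xs → ∃ λ w → prefixVec n xs ≡ just w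
  prefixVec-long zero    xs       _ = [] , refl
  prefixVec-long (suc n) (x ∷ xs) (s≤s n≤|xs|) with prefixVec n xs | prefixVec-long n xs n≤|xs|
  ... | just w | _ = x ∷ w , refl

  prefixVec-++ : ∀ n (xs ys : List A) → n ≤ length xs → prefixVec n (xs ++ ys) ≡ prefixVec n xs
  prefixVec-++ zero    xs       ys _ = refl
  prefixVec-++ (suc n) (x ∷ xs) ys (s≤s n≤|xs|) rewrite prefixVec-++ n xs ys n≤|xs| = refl

  take-++ˡ : ∀ {n} (xs : List A) {ys} → length xs ≡ n → take n (xs ++ ys) ≡ xs
  take-++ˡ []       refl = refl
  take-++ˡ (x ∷ xs) refl = cong (x ∷_) (take-++ˡ xs refl)

  take-reverse-++ʳ : ∀ {n} (xs ys : List A) → length ys ≡ n → take n (reverse (xs ++ ys)) ≡ reverse ys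
  take-reverse-++ʳ xs ys |ys|≡n rewrite reverse-++ xs ys =
    take-++ˡ (reverse ys) (trans (length-reverse ys) |ys|≡n)

  take-≤-cong : ∀ {m n} (xs ys : List A) → m ≤ n → take n xs ≡ take n ys → take m xs ≡ take m ys
  take-≤-cong {m} {n} xs ys m≤n eq = begin
    take m xs             ≡⟨ cong (λ k → take k xs) (m≤n⇒m⊓n≡m m≤n) ⟨
    take (m ⊓ n) xs       ≡⟨ take-take m n xs ⟨
    take m (take n xs)    ≡⟨ cong (take m) eq ⟩
    take m (take n ys)    ≡⟨ take-take m n ys ⟩
    take (m ⊓ n) ys       ≡⟨ cong (λ k → take k ys) (m≤n⇒m⊓n≡m m≤n) ⟩
    take m ys             ∎
    where open ≡-Reasoning

  ∃-prefix : ∀ n (xs : List A) → n ≤ length xs → ∃₂ λ ys zs → length ys ≡ n × xs ≡ ys ++ zs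
  ∃-prefix n xs n≤|xs| =
    take n xs , drop n xs , trans (length-take n xs) (m≤n⇒m⊓n≡m n≤|xs|) , sym (take++drop≡id n xs)

  ∃-suffix : ∀ n (xs : List A) → n ≤ length xs → ∃₂ λ ys zs → length zs ≡ n × xs ≡ ys ++ zs
  ∃-suffix n xs n≤|xs| =
    take k xs , drop k xs , trans (length-drop k xs) (m∸[m∸n]≡n n≤|xs|) , sym (take++drop≡id k xs)
    where
    k : ℕ
    k = length xs ∸ n

  ∃-ends : ∀ n (xs : List A) → n + n ≤ length xs →
           ∃₂ λ ps ms → ∃ λ ss → length ps ≡ n × length ss ≡ n × xs ≡ ps ++ ms ++ ss
  ∃-ends n xs 2n≤|xs| with ∃-prefix n xs (≤-trans (m≤m+n n n) 2n≤|xs|)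
  ... | ps , ys , |ps|≡n , refl with ∃-suffix n ys n≤|ys|
    where
    n≤|ys| : n ≤ length ys
    n≤|ys| = +-cancelˡ-≤ n n (length ys)
      (subst (n + n ≤_) (trans (length-++ ps) (cong (_+ length ys) |ps|≡n)) 2n≤|xs|)
  ...   | ms , ss , |ss|≡n , refl = ps , ms , ss , |ps|≡n , |ss|≡n , refl

  ++-shared-prefix : ∀ {n} (qs xs ys : List A) → length qs ≡ n → take n (qs ++ xs) ≡ take n ys →
                     ys ≡ qs ++ drop n ys
  ++-shared-prefix {n} qs xs ys |qs|≡n same-prefix = begin
    ys                     ≡⟨ take++drop≡id n ys ⟨
    take n ys ++ drop n ys ≡⟨ cong (_++ drop n ys) (trans (sym same-prefix) (take-++ˡ qs |qs|≡n)) ⟩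
    qs ++ drop n ys        ∎
    where open ≡-Reasoning

  ++-shared-suffix : ∀ {n} (xs ys ss rs : List A) → length ss ≡ n → length rs ≡ n →
                     take n (reverse (xs ++ ss)) ≡ take n (reverse (ys ++ rs)) → ss ≡ rs
  ++-shared-suffix {n} xs ys ss rs |ss|≡n |rs|≡n same-suffix = reverse-injective (begin
    reverse ss                  ≡⟨ take-reverse-++ʳ xs ss |ss|≡n ⟨
    take n (reverse (xs ++ ss)) ≡⟨ same-suffix ⟩
    take n (reverse (ys ++ rs)) ≡⟨ take-reverse-++ʳ ys rs |rs|≡n ⟩
    reverse rs                  ∎)
    where open ≡-Reasoning

  length-++-cong : ∀ {xs ys zs ws : List A} → length xs ≡ length ys → length zs ≡ length ws →
                   length (xs ++ zs) ≡ length (ys ++ ws)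
  length-++-cong {xs} {ys} {zs} {ws} eq₁ eq₂ rewrite length-++ xs {zs} | length-++ ys {ws} =
    cong₂ _+_ eq₁ eq₂

  length-concat-replicate-cong : ∀ n {xs ys : List A} → length xs ≡ length ys →
                                 length (concat (replicate n xs)) ≡ length (concat (replicate n ys))
  length-concat-replicate-cong zero    eq = refl
  length-concat-replicate-cong (suc n) {xs} {ys} eq =
    length-++-cong {xs = xs} {ys} eq (length-concat-replicate-cong n eq)

module Windows {A : Set} {t : ℕ} (f : Vec A (suc t) → List A) where

  f* : List A → List A
  f* = fstar (suc t) f

  ∣f*_∣ : List A → ℕ
  ∣f* u ∣ = length (f* u)

  f*-short : ∀ (xs : List A) → length xs ≤ t → f* xs ≡ []
  f*-short []       _ = refl
  f*-short (x ∷ xs) |x∷xs|≤t rewrite prefixVec-short (suc t) (x ∷ xs) (s≤s |x∷xs|≤t) = refl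

  f*-∷ : ∀ {w} x (xs : List A) → prefixVec (suc t) (x ∷ xs) ≡ just w → f* (x ∷ xs) ≡ f w ++ f* xs
  f*-∷ x xs eq rewrite eq = refl

  f*-∷-long : ∀ x (xs : List A) → t ≤ length xs → ∃ λ w → f* (x ∷ xs) ≡ f w ++ f* xs
  f*-∷-long x xs t≤|xs| with prefixVec-long (suc t) (x ∷ xs) (s≤s t≤|xs|)
  ... | w , eq = w , f*-∷ x xs eq

  f*-++-overlap : ∀ (xs : List A) {rs} ys → length rs ≡ t →
                  f* (xs ++ rs ++ ys) ≡ f* (xs ++ rs) ++ f* (rs ++ ys)
  f*-++-overlap []       {rs} ys |rs|≡t rewrite f*-short rs (≤-reflexive |rs|≡t) = refl
  f*-++-overlap (x ∷ xs) {rs} ys |rs|≡t = begin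
    f* (x ∷ xs ++ rs ++ ys)                  ≡⟨ f*-∷ x _ eq-extended ⟩
    f w ++ f* (xs ++ rs ++ ys)               ≡⟨ cong (f w ++_) (f*-++-overlap xs ys |rs|≡t) ⟩
    f w ++ f* (xs ++ rs) ++ f* (rs ++ ys)    ≡⟨ ++-assoc (f w) _ _ ⟨
    (f w ++ f* (xs ++ rs)) ++ f* (rs ++ ys)  ≡⟨ cong (_++ f* (rs ++ ys)) (f*-∷ x _ eq) ⟨
    f* (x ∷ xs ++ rs) ++ f* (rs ++ ys)       ∎
    where
    open ≡-Reasoning
    t≤|xs++rs| : t ≤ length (xs ++ rs)
    t≤|xs++rs| = ≤-trans (≤-reflexive (sym |rs|≡t)) (length-++-≤ʳ rs {xs})
    first-window : ∃ λ w → prefixVec (suc t) (x ∷ xs ++ rs) ≡ just w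
    first-window = prefixVec-long (suc t) (x ∷ xs ++ rs) (s≤s t≤|xs++rs|)
    w : Vec A (suc t)
    w = proj₁ first-window
    eq : prefixVec (suc t) (x ∷ xs ++ rs) ≡ just w
    eq = proj₂ first-window
    eq-extended : prefixVec (suc t) (x ∷ xs ++ rs ++ ys) ≡ just w
    eq-extended = begin
      prefixVec (suc t) (x ∷ xs ++ rs ++ ys)
        ≡⟨ cong (λ zs → prefixVec (suc t) (x ∷ zs)) (++-assoc xs rs ys) ⟨
      prefixVec (suc t) ((x ∷ xs ++ rs) ++ ys)
        ≡⟨ prefixVec-++ (suc t) (x ∷ xs ++ rs) ys (s≤s t≤|xs++rs|) ⟩
      prefixVec (suc t) (x ∷ xs ++ rs)          ≡⟨ eq ⟩
      just w                                    ∎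

  ∣f*∣-++-overlap : ∀ (xs : List A) {rs} ys → length rs ≡ t →
                    ∣f* (xs ++ rs ++ ys) ∣ ≡ ∣f* (xs ++ rs) ∣ + ∣f* (rs ++ ys) ∣
  ∣f*∣-++-overlap xs {rs} ys |rs|≡t =
    trans (cong length (f*-++-overlap xs ys |rs|≡t)) (length-++ (f* (xs ++ rs)))

  ∣f*∣-pump : ∀ n (xs ss : List A) → length ss ≡ t →
              ∣f* (ss ++ concat (replicate n (xs ++ ss))) ∣ ≡ n * ∣f* (ss ++ xs ++ ss) ∣
  ∣f*∣-pump zero    xs ss |ss|≡t rewrite ++-identityʳ ss | f*-short ss (≤-reflexive |ss|≡t) = refl
  ∣f*∣-pump (suc n) xs ss |ss|≡t = begin
    ∣f* (ss ++ (xs ++ ss) ++ rest) ∣               ≡⟨ cong ∣f*_∣ reassociate ⟩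
    ∣f* ((ss ++ xs) ++ ss ++ rest) ∣               ≡⟨ ∣f*∣-++-overlap (ss ++ xs) rest |ss|≡t ⟩
    ∣f* ((ss ++ xs) ++ ss) ∣ + ∣f* (ss ++ rest) ∣  ≡⟨ cong₂ _+_ (cong ∣f*_∣ (++-assoc ss xs ss))
                                                             (∣f*∣-pump n xs ss |ss|≡t) ⟩
    suc n * ∣f* (ss ++ xs ++ ss) ∣                 ∎
    where
    open ≡-Reasoning
    rest : List A
    rest = concat (replicate n (xs ++ ss))
    reassociate : ss ++ (xs ++ ss) ++ rest ≡ (ss ++ xs) ++ ss ++ rest
    reassociate = trans (cong (ss ++_) (++-assoc xs ss rest)) (sym (++-assoc ss xs (ss ++ rest)))

  ∣f*∣-∷-≥ : ∀ x (xs : List A) → ∣f* xs ∣ ≤ ∣f* (x ∷ xs) ∣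
  ∣f*∣-∷-≥ x xs with t ≤? length xs
  ... | yes t≤|xs| with f*-∷-long x xs t≤|xs|
  ...   | w , eq rewrite eq | length-++ (f w) {f* xs} = m≤n+m _ _
  ∣f*∣-∷-≥ x xs | no t≰|xs| rewrite f*-short xs (<⇒≤ (≰⇒> t≰|xs|)) = z≤n

  ∣f*∣-++ˡ-≥ : ∀ (xs ys : List A) → ∣f* ys ∣ ≤ ∣f* (xs ++ ys) ∣
  ∣f*∣-++ˡ-≥ []       ys = ≤-refl
  ∣f*∣-++ˡ-≥ (x ∷ xs) ys = ≤-trans (∣f*∣-++ˡ-≥ xs ys) (∣f*∣-∷-≥ x (xs ++ ys))

  ∣f*∣-++ʳ-≡ : ∀ (xs rs ys : List A) → length rs ≡ t →
               ∣f* ((xs ++ rs) ++ ys) ∣ ≡ ∣f* (xs ++ rs) ∣ + ∣f* (rs ++ ys) ∣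
  ∣f*∣-++ʳ-≡ xs rs ys |rs|≡t =
    trans (cong ∣f*_∣ (++-assoc xs rs ys)) (∣f*∣-++-overlap xs ys |rs|≡t)

  ∣f*∣-++ʳ-≥ : ∀ (xs ys : List A) → ∣f* xs ∣ ≤ ∣f* (xs ++ ys) ∣
  ∣f*∣-++ʳ-≥ xs ys with t ≤? length xs
  ... | yes t≤|xs| with ∃-suffix t xs t≤|xs|
  ...   | zs , rs , |rs|≡t , refl =
    ≤-trans (m≤m+n _ _) (≤-reflexive (sym (∣f*∣-++ʳ-≡ zs rs ys |rs|≡t)))
  ∣f*∣-++ʳ-≥ xs ys | no t≰|xs| rewrite f*-short xs (<⇒≤ (≰⇒> t≰|xs|)) = z≤n

  module _ {M : ℕ} (|f|≤M : ∀ w → length (f w) ≤ M) where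

    ∣f*∣-∷-≤ : ∀ x (xs : List A) → ∣f* (x ∷ xs) ∣ ≤ M + ∣f* xs ∣
    ∣f*∣-∷-≤ x xs with t ≤? length xs
    ... | yes t≤|xs| with f*-∷-long x xs t≤|xs|
    ...   | w , eq rewrite eq | length-++ (f w) {f* xs} = +-monoˡ-≤ _ (|f|≤M w)
    ∣f*∣-∷-≤ x xs | no t≰|xs| rewrite f*-short (x ∷ xs) (≰⇒> t≰|xs|) = z≤n

    ∣f*∣-≤ : ∀ (xs : List A) → ∣f* xs ∣ ≤ (length xs ∸ t) * M
    ∣f*∣-≤ []       = z≤n
    ∣f*∣-≤ (x ∷ xs) with t ≤? length xs
    ... | yes t≤|xs| = begin
      ∣f* (x ∷ xs) ∣                ≤⟨ ∣f*∣-∷-≤ x xs ⟩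
      M + ∣f* xs ∣                  ≤⟨ +-monoʳ-≤ M (∣f*∣-≤ xs) ⟩
      suc (length xs ∸ t) * M       ≡⟨ cong (_* M) (+-∸-assoc 1 t≤|xs|) ⟨
      (suc (length xs) ∸ t) * M     ∎
      where open ≤-Reasoning
    ... | no t≰|xs| rewrite f*-short (x ∷ xs) (≰⇒> t≰|xs|) = z≤n

    ∣f*∣-++ˡ-≤ : ∀ (xs ys : List A) → ∣f* (xs ++ ys) ∣ ≤ length xs * M + ∣f* ys ∣
    ∣f*∣-++ˡ-≤ []       ys = ≤-refl
    ∣f*∣-++ˡ-≤ (x ∷ xs) ys = ≤-trans (∣f*∣-∷-≤ x (xs ++ ys))
      (≤-trans (+-monoʳ-≤ M (∣f*∣-++ˡ-≤ xs ys)) (≤-reflexive (sym (+-assoc M _ _))))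

    ∣f*∣-short-++-≤ : ∀ (xs ys : List A) → length xs ≤ t → ∣f* (xs ++ ys) ∣ ≤ length ys * M
    ∣f*∣-short-++-≤ xs ys |xs|≤t = ≤-trans (∣f*∣-≤ (xs ++ ys)) (*-monoˡ-≤ M windows≤|ys|)
      where
      windows≤|ys| : length (xs ++ ys) ∸ t ≤ length ys
      windows≤|ys| rewrite length-++ xs {ys} =
        ≤-trans (∸-monoˡ-≤ t (+-monoˡ-≤ (length ys) |xs|≤t)) (≤-reflexive (m+n∸m≡n t (length ys)))

    ∣f*∣-++ʳ-≤ : ∀ (xs ys : List A) → ∣f* (xs ++ ys) ∣ ≤ ∣f* xs ∣ + length ys * M
    ∣f*∣-++ʳ-≤ xs ys with t ≤? length xs
    ... | yes t≤|xs| with ∃-suffix t xs t≤|xs|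
    ...   | zs , rs , |rs|≡t , refl rewrite ∣f*∣-++ʳ-≡ zs rs ys |rs|≡t =
      +-monoʳ-≤ _ (∣f*∣-short-++-≤ rs ys (≤-reflexive |rs|≡t))
    ∣f*∣-++ʳ-≤ xs ys | no t≰|xs| =
      ≤-trans (∣f*∣-short-++-≤ xs ys (<⇒≤ (≰⇒> t≰|xs|))) (m≤n+m _ _)

    ∣f*∣-replace-prefix : ∀ (xs ys zs : List A) → ∣f* (xs ++ zs) ∣ ≤ ∣f* (ys ++ zs) ∣ + length xs * M
    ∣f*∣-replace-prefix xs ys zs = begin
      ∣f* (xs ++ zs) ∣                 ≤⟨ ∣f*∣-++ˡ-≤ xs zs ⟩
      length xs * M + ∣f* zs ∣         ≤⟨ +-monoʳ-≤ _ (∣f*∣-++ˡ-≥ ys zs) ⟩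
      length xs * M + ∣f* (ys ++ zs) ∣ ≡⟨ +-comm (length xs * M) _ ⟩
      ∣f* (ys ++ zs) ∣ + length xs * M ∎
      where open ≤-Reasoning

    ∣f*∣-replace-suffix : ∀ (xs ys zs : List A) → ∣f* (xs ++ ys) ∣ ≤ ∣f* (xs ++ zs) ∣ + length ys * M
    ∣f*∣-replace-suffix xs ys zs =
      ≤-trans (∣f*∣-++ʳ-≤ xs ys) (+-monoˡ-≤ (length ys * M) (∣f*∣-++ʳ-≥ xs zs))

    ∣f*∣-replace-ends : ∀ (ps qs ms ss rs : List A) →
                        ∣f* (ps ++ ms ++ ss) ∣ ≤ ∣f* (qs ++ ms ++ rs) ∣ + (length ss + length ps) * M
    ∣f*∣-replace-ends ps qs ms ss rs = begin
      ∣f* (ps ++ ms ++ ss) ∣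
        ≤⟨ ∣f*∣-replace-prefix ps qs (ms ++ ss) ⟩
      ∣f* (qs ++ ms ++ ss) ∣ + length ps * M
        ≡⟨ cong (λ w → ∣f* w ∣ + length ps * M) (++-assoc qs ms ss) ⟨
      ∣f* ((qs ++ ms) ++ ss) ∣ + length ps * M
        ≤⟨ +-monoˡ-≤ (length ps * M) (∣f*∣-replace-suffix (qs ++ ms) ss rs) ⟩
      ∣f* ((qs ++ ms) ++ rs) ∣ + length ss * M + length ps * M
        ≡⟨ cong (λ w → ∣f* w ∣ + length ss * M + length ps * M) (++-assoc qs ms rs) ⟩
      ∣f* (qs ++ ms ++ rs) ∣ + length ss * M + length ps * M
        ≡⟨ +-assoc ∣f* (qs ++ ms ++ rs) ∣ (length ss * M) (length ps * M) ⟩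
      ∣f* (qs ++ ms ++ rs) ∣ + (length ss * M + length ps * M)
        ≡⟨ cong (λ k → ∣f* (qs ++ ms ++ rs) ∣ + k) (*-distribʳ-+ M (length ss) (length ps)) ⟨
      ∣f* (qs ++ ms ++ rs) ∣ + (length ss + length ps) * M
        ∎
      where open ≤-Reasoning

    diamondUniform⇒bounded : DiamondUniform (suc t) f → ∀ (u v : List A) → length u ≡ length v →
                             ∣f* u ∣ ≤ ∣f* v ∣ + (suc t + suc t) * M
    diamondUniform⇒bounded du u v |u|≡|v| with suc t + suc t ≤? length u
    ... | no 2θ≰|u| = ≤-trans (∣f*∣-≤ u) (≤-trans (*-monoˡ-≤ M windows≤2θ) (m≤n+m _ ∣f* v ∣))
      where
      windows≤2θ : length u ∸ t ≤ suc t + suc t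
      windows≤2θ = ≤-trans (m∸n≤m (length u) t) (<⇒≤ (≰⇒> 2θ≰|u|))
    ... | yes 2θ≤|u|
      with ∃-ends (suc t) u 2θ≤|u| | ∃-ends (suc t) v (≤-trans 2θ≤|u| (≤-reflexive |u|≡|v|))
    ...   | ps , ms , ss , |ps|≡θ , |ss|≡θ , refl | qs , ns , rs , |qs|≡θ , |rs|≡θ , refl = begin
      ∣f* (ps ++ ms ++ ss) ∣                              ≤⟨ ∣f*∣-replace-ends ps qs ms ss rs ⟩
      ∣f* (qs ++ ms ++ rs) ∣ + (length ss + length ps) * M ≡⟨ cong₂ _+_ same-ends ends-have-length-θ ⟩
      ∣f* (qs ++ ns ++ rs) ∣ + (suc t + suc t) * M         ∎
      where
      open ≤-Reasoning
      ends-have-length-θ : (length ss + length ps) * M ≡ (suc t + suc t) * M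
      ends-have-length-θ = cong₂ (λ a b → (a + b) * M) |ss|≡θ |ps|≡θ
      starts-with-qs : ∀ zs → take (suc t) (qs ++ zs ++ rs) ≡ qs
      starts-with-qs zs = take-++ˡ qs |qs|≡θ
      ends-with-rs : ∀ zs → take (suc t) (reverse (qs ++ zs ++ rs)) ≡ reverse rs
      ends-with-rs zs = trans (cong (λ w → take (suc t) (reverse w)) (sym (++-assoc qs zs rs)))
                              (take-reverse-++ʳ (qs ++ zs) rs |rs|≡θ)
      same-length : length (qs ++ ms ++ rs) ≡ length (qs ++ ns ++ rs)
      same-length = trans (length-++-cong {xs = qs} {ps} (trans |qs|≡θ (sym |ps|≡θ))
                            (length-++-cong {xs = ms} {ms} {rs} {ss} refl (trans |rs|≡θ (sym |ss|≡θ))))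
                          |u|≡|v|
      same-ends : ∣f* (qs ++ ms ++ rs) ∣ ≡ ∣f* (qs ++ ns ++ rs) ∣
      same-ends = du _ (qs ++ ms ++ rs) (qs ++ ns ++ rs) same-length refl
                     (trans (starts-with-qs ms) (sym (starts-with-qs ns)))
                     (trans (ends-with-rs ms) (sym (ends-with-rs ns)))

  module _ {K : ℕ} (bounded : ∀ (u v : List A) → length u ≡ length v → ∣f* u ∣ ≤ ∣f* v ∣ + K) where

    ∣f*∣-pumped-≤ : ∀ (xs ys ss : List A) → length ss ≡ t → length (xs ++ ss) ≡ length (ys ++ ss) →
                    ∣f* (ss ++ xs ++ ss) ∣ ≤ ∣f* (ss ++ ys ++ ss) ∣
    ∣f*∣-pumped-≤ xs ys ss |ss|≡t |xs++ss|≡|ys++ss| = *-gap-bounded⇒≤ K λ n →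
      subst₂ (λ a b → a ≤ b + K) (∣f*∣-pump n xs ss |ss|≡t) (∣f*∣-pump n ys ss |ss|≡t)
        (bounded (pumped n xs) (pumped n ys)
          (length-++-cong {xs = ss} {ss} refl (length-concat-replicate-cong n |xs++ss|≡|ys++ss|)))
      where
      pumped : ℕ → List A → List A
      pumped n zs = ss ++ concat (replicate n (zs ++ ss))

    ∣f*∣-common-ends-≤ : ∀ (u v : List A) → length u ≡ length v → t ≤ length u →
                         take t u ≡ take t v → take t (reverse u) ≡ take t (reverse v) →
                         ∣f* u ∣ ≤ ∣f* v ∣
    ∣f*∣-common-ends-≤ u v |u|≡|v| t≤|u| same-prefix same-suffix
      with ∃-prefix t u t≤|u| | ∃-suffix t u t≤|u| | ∃-suffix t v (≤-trans t≤|u| (≤-reflexive |u|≡|v|))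
    ... | qs , us , |qs|≡t , refl | u₀ , ss , |ss|≡t , u≡u₀++ss | v₀ , rs , |rs|≡t , refl =
      +-cancelˡ-≤ ∣f* (ss ++ qs) ∣ ∣f* (qs ++ us) ∣ ∣f* (v₀ ++ rs) ∣ (begin
        ∣f* (ss ++ qs) ∣ + ∣f* (qs ++ us) ∣  ≡⟨ ∣f*∣-++-overlap ss us |qs|≡t ⟨
        ∣f* (ss ++ qs ++ us) ∣               ≡⟨ cong (λ w → ∣f* (ss ++ w) ∣) u≡u₀++ss ⟩
        ∣f* (ss ++ u₀ ++ ss) ∣               ≤⟨ ∣f*∣-pumped-≤ u₀ v₀ ss |ss|≡t same-length ⟩
        ∣f* (ss ++ v₀ ++ ss) ∣               ≡⟨ cong (λ w → ∣f* (ss ++ v₀ ++ w) ∣) ss≡rs ⟩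
        ∣f* (ss ++ v₀ ++ rs) ∣               ≡⟨ cong (λ w → ∣f* (ss ++ w) ∣) v≡qs++vs ⟩
        ∣f* (ss ++ qs ++ vs) ∣               ≡⟨ ∣f*∣-++-overlap ss vs |qs|≡t ⟩
        ∣f* (ss ++ qs) ∣ + ∣f* (qs ++ vs) ∣  ≡⟨ cong (λ w → ∣f* (ss ++ qs) ∣ + ∣f* w ∣) v≡qs++vs ⟨
        ∣f* (ss ++ qs) ∣ + ∣f* (v₀ ++ rs) ∣  ∎)
      where
      open ≤-Reasoning
      vs : List A
      vs = drop t (v₀ ++ rs)
      v≡qs++vs : v₀ ++ rs ≡ qs ++ vs
      v≡qs++vs = ++-shared-prefix qs us (v₀ ++ rs) |qs|≡t same-prefix
      ss≡rs : ss ≡ rs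
      ss≡rs = ++-shared-suffix u₀ v₀ ss rs |ss|≡t |rs|≡t
                (trans (cong (λ w → take t (reverse w)) (sym u≡u₀++ss)) same-suffix)
      same-length : length (u₀ ++ ss) ≡ length (v₀ ++ ss)
      same-length = trans (cong length (sym u≡u₀++ss))
                          (trans |u|≡|v| (cong (λ w → length (v₀ ++ w)) (sym ss≡rs)))

    bounded⇒diamondUniform : DiamondUniform (suc t) f
    bounded⇒diamondUniform ℓ u v |u|≡ℓ |v|≡ℓ same-prefix same-suffix with t ≤? length u
    ... | yes t≤|u| = ≤-antisym
      (∣f*∣-common-ends-≤ u v |u|≡|v| t≤|u| prefix-t suffix-t)
      (∣f*∣-common-ends-≤ v u (sym |u|≡|v|) (≤-trans t≤|u| (≤-reflexive |u|≡|v|))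
                          (sym prefix-t) (sym suffix-t))
      where
      |u|≡|v| : length u ≡ length v
      |u|≡|v| = trans |u|≡ℓ (sym |v|≡ℓ)
      prefix-t : take t u ≡ take t v
      prefix-t = take-≤-cong u v (n≤1+n t) same-prefix
      suffix-t : take t (reverse u) ≡ take t (reverse v)
      suffix-t = take-≤-cong (reverse u) (reverse v) (n≤1+n t) same-suffix
    ... | no t≰|u| rewrite f*-short u (<⇒≤ (≰⇒> t≰|u|))
                         | f*-short v (<⇒≤ (≰⇒> (subst (t ≰_) (trans |u|≡ℓ (sym |v|≡ℓ)) t≰|u|))) = refl

lemma3 : (k θ : ℕ) → 1 ≤ θ → (f : Vec (Fin k) θ → List (Fin k)) → IsLocalRule θ f →
    DiamondUniform θ f ⇔
      Σ ℤ (λ C → (u v : List (Fin k)) → length u ≡ length v →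
        (+ length (fstar θ f u)) Data.Integer.- (+ length (fstar θ f v)) Data.Integer.≤ C)
lemma3 k (suc t) _ f _ = mk⇔
  (λ du → + ((suc t + suc t) * M) , λ u v |u|≡|v| →
     m≤n+o⇒[+m]-[+n]≤+o {n = ∣f* v ∣} (diamondUniform⇒bounded |f|≤M du u v |u|≡|v|))
  (λ (C , bounded) → bounded⇒diamondUniform λ u v |u|≡|v| →
     [+m]-[+n]≤+o⇒m≤n+o (ℤ.≤-trans (bounded u v |u|≡|v|) (i≤+∣i∣ C)))
  where
  open Windows f
  M : ℕ
  M = proj₁ (Vec-Fin-bounded (suc t) (λ w → length (f w)))
  |f|≤M : ∀ w → length (f w) ≤ M
  |f|≤M = proj₂ (Vec-Fin-bounded (suc t) (λ w → length (f w)))
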